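{- Let $n\ge2$ be an integer. There is an injective map from $B_1$ to $A$, where $A$ is the set of ordered pairs $(\gamma,\delta)$ of $(n-1)$-cycles on $\{0,1,\dots,n-2\}$ with $\gamma\circ\delta=X_{n-2}$, and $B_1$ is the set of ordered pairs $(\gamma_1,\delta_1)$ of $(n+1)$-cycles on $\{0,1,\dots,n\}$ with $\gamma_1\circ\delta_1=X_n$ and $\delta_1$ of the form $(0\;n\;1\;\cdots)$ (i.e. $\delta_1(0)=n$ and $\delta_1(n)=1$).
   Context: For $m\ge0$, $X_m$ denotes the cycle $(0\;1\;2\;\cdots\;m)$ on $\{0,\dots,m\}$. Cycle notation $(c_1\cdots c_k)$ sends $c_1\mapsto c_2\mapsto\cdots\mapsto c_k\mapsto c_1$; composition is right-to-left. -}

module Defs where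

open import Data.Nat.Base using (ℕ; zero; suc)
open import Data.Nat.Properties using (_≟_)
open import Data.Fin.Base using (Fin; zero; suc; toℕ; fromℕ; lower₁)
open import Data.Fin.Permutation using (Permutation′; _⟨$⟩ʳ_)
open import Data.Product.Base using (Σ; ∃-syntax; _×_; _,_; proj₁)
open import Relation.Nullary using (yes; no)
open import Relation.Binary.PropositionalEquality using (_≡_)

Perm : ℕ → Set
Perm m = Permutation′ m

iter : ∀ {m} → Perm m → ℕ → Fin m → Fin m
iter σ zero    x = x
iter σ (suc k) x = σ ⟨$⟩ʳ iter σ k x

-- σ is an m-cycle on {0,…,m-1}: it consists of a single cycle of length m,
-- i.e. every point reaches every point under iteration of σ.
IsFullCycle : ∀ {m} → Perm m → Set
IsFullCycle {m} σ = ∀ (i j : Fin m) → ∃[ k ] iter σ k i ≡ j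

-- The cycle X_m = (0 1 2 ⋯ m) on {0,…,m} : i ↦ i+1 for i < m, m ↦ 0.
X : ∀ m → Fin (suc m) → Fin (suc m)
X m i with m ≟ toℕ i
... | yes _ = zero
... | no ne = suc (lower₁ i ne)

_≈ₚ_ : ∀ {m} → Perm m → Perm m → Set
_≈ₚ_ {m} σ τ = ∀ (i : Fin m) → σ ⟨$⟩ʳ i ≡ τ ⟨$⟩ʳ i

FactPair : ℕ → Set
FactPair j = Σ (Perm (suc j) × Perm (suc j)) λ { (γ , δ) →
  IsFullCycle γ × IsFullCycle δ × (∀ i → γ ⟨$⟩ʳ (δ ⟨$⟩ʳ i) ≡ X j i) }

-- For n = k + 2:
-- A  : pairs of (n-1)-cycles on {0,…,n-2} with γ ∘ δ = X_{n-2}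
SetA : ℕ → Set
SetA k = FactPair k

SetB₁ : ℕ → Set
SetB₁ k = Σ (FactPair (suc (suc k))) λ p →
  let δ₁ = Data.Product.Base.proj₂ (proj₁ p) in
  (δ₁ ⟨$⟩ʳ zero ≡ fromℕ (suc (suc k))) × (δ₁ ⟨$⟩ʳ fromℕ (suc (suc k)) ≡ suc zero)

_≈FP_ : ∀ {j} → FactPair j → FactPair j → Set
((γ , δ) , _) ≈FP ((γ' , δ') , _) = (γ ≈ₚ γ') × (δ ≈ₚ δ')

-- A pair (γ₁, δ₁) in B₁ is contracted to a pair on {0,…,n-2} by deleting the
-- points 0 and n and relabelling i ↦ i-1.  The contracted δ is the first-return
-- map of δ₁ on {1,…,n-1} (the detour 0 ↦ n ↦ 1 of δ₁ is skipped), and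
-- γ := X_{n-2} ∘ δ⁻¹ is likewise the first-return map of γ₁ = X_n ∘ δ₁⁻¹, whose
-- detours are 1 ↦ 0 ↦ ⋯ and ⋯ ↦ n ↦ 1.  A first-return map of a full cycle is a full
-- cycle, so the contraction lands in A.  It is injective because δ₁ is fixed
-- on {0, n}, is recovered from δ on the remaining points, and determines γ₁.
module Submission where

open import Defs
open import Data.Nat.Base using (ℕ; zero; suc; _<_; _≤_; s≤s)
open import Data.Nat.Properties using (_≟_; ≤-refl; m≤n⇒m≤1+n; <⇒≢)
open import Data.Nat.Induction using (<-wellFounded)
open import Induction.WellFounded using (Acc; acc)
open import Data.Fin.Base using (Fin; zero; suc; toℕ; fromℕ; inject₁; pinch)
open import Data.Fin.Properties
  using (toℕ-fromℕ; toℕ-inject₁; toℕ<n; lower₁-inject₁′; fromℕ≢inject₁; suc-injective; inject₁-injective)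
open import Data.Fin.Relation.Unary.Top using (view; ‵fromℕ; ‵inject₁)
open import Data.Fin.Permutation using (_⟨$⟩ʳ_; _⟨$⟩ˡ_; permutation; inverseˡ; inverseʳ; flip; _∘ₚ_)
open import Data.Product.Base using (Σ; ∃-syntax; _×_; _,_; proj₁)
open import Data.Empty using (⊥-elim)
open import Function.Base using (_∘_)
open import Function.Bundles using (Injection)
open import Function.Definitions using (Injective)
open import Function.Properties.Inverse using (↔⇒↣)
open import Relation.Nullary using (yes; no)
open import Relation.Binary.PropositionalEquality
  using (_≡_; _≢_; refl; sym; trans; cong; module ≡-Reasoning)

open ≡-Reasoning

⟨$⟩ʳ-injective : ∀ {m} (σ : Perm m) → Injective _≡_ _≡_ (σ ⟨$⟩ʳ_)
⟨$⟩ʳ-injective σ = Injection.injective (↔⇒↣ σ)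

⟨$⟩ˡ-cong : ∀ {m} (σ σ′ : Perm m) → σ ≈ₚ σ′ → ∀ x → σ ⟨$⟩ˡ x ≡ σ′ ⟨$⟩ˡ x
⟨$⟩ˡ-cong σ σ′ σ≈σ′ x = begin
  σ ⟨$⟩ˡ x                         ≡⟨ inverseˡ σ′ ⟨
  σ′ ⟨$⟩ˡ (σ′ ⟨$⟩ʳ (σ ⟨$⟩ˡ x))     ≡⟨ cong (σ′ ⟨$⟩ˡ_) (σ≈σ′ (σ ⟨$⟩ˡ x)) ⟨
  σ′ ⟨$⟩ˡ (σ ⟨$⟩ʳ (σ ⟨$⟩ˡ x))      ≡⟨ cong (σ′ ⟨$⟩ˡ_) (inverseʳ σ) ⟩
  σ′ ⟨$⟩ˡ x                        ∎

≈ₚ-cancelʳ : ∀ {m} (γ γ′ δ δ′ : Perm m) → δ ≈ₚ δ′ →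
             (∀ i → γ ⟨$⟩ʳ (δ ⟨$⟩ʳ i) ≡ γ′ ⟨$⟩ʳ (δ′ ⟨$⟩ʳ i)) → γ ≈ₚ γ′
≈ₚ-cancelʳ γ γ′ δ δ′ δ≈δ′ γδ≡γ′δ′ x = begin
  γ ⟨$⟩ʳ x                         ≡⟨ cong (γ ⟨$⟩ʳ_) (inverseʳ δ) ⟨
  γ ⟨$⟩ʳ (δ ⟨$⟩ʳ (δ ⟨$⟩ˡ x))       ≡⟨ γδ≡γ′δ′ (δ ⟨$⟩ˡ x) ⟩
  γ′ ⟨$⟩ʳ (δ′ ⟨$⟩ʳ (δ ⟨$⟩ˡ x))     ≡⟨ cong (γ′ ⟨$⟩ʳ_) (δ≈δ′ (δ ⟨$⟩ˡ x)) ⟨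
  γ′ ⟨$⟩ʳ (δ ⟨$⟩ʳ (δ ⟨$⟩ˡ x))      ≡⟨ cong (γ′ ⟨$⟩ʳ_) (inverseʳ δ) ⟩
  γ′ ⟨$⟩ʳ x                        ∎

iter-sucʳ : ∀ {m} (σ : Perm m) k x → iter σ (suc k) x ≡ iter σ k (σ ⟨$⟩ʳ x)
iter-sucʳ σ zero    x = refl
iter-sucʳ σ (suc k) x = cong (σ ⟨$⟩ʳ_) (iter-sucʳ σ k x)

module _ {M m} (σ : Perm M) (e : Fin m → Fin M) where

  data Excursion : Fin M → Fin M → Set where
    arrive : ∀ {x y} → σ ⟨$⟩ʳ x ≡ y → Excursion x y
    pass   : ∀ {x y} → (∀ j → σ ⟨$⟩ʳ x ≢ e j) → Excursion (σ ⟨$⟩ʳ x) y → Excursion x y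

  IsFirstReturn : Perm m → Set
  IsFirstReturn τ = ∀ j → Excursion (e j) (e (τ ⟨$⟩ʳ j))

  excursion-skip : ∀ {x y} → Excursion x y → ∀ K {j} → iter σ (suc K) x ≡ e j →
                   ∃[ K′ ] K′ ≤ K × iter σ K′ y ≡ e j
  excursion-skip (arrive refl) K q = K , ≤-refl , trans (sym (iter-sucʳ σ K _)) q
  excursion-skip (pass out ex) zero q = ⊥-elim (out _ q)
  excursion-skip (pass out ex) (suc K) q
    with excursion-skip ex K (trans (sym (iter-sucʳ σ (suc K) _)) q)
  ... | K′ , K′≤K , r = K′ , m≤n⇒m≤1+n K′≤K , r

module _ {M m} {σ : Perm M} {e : Fin m → Fin M} {τ : Perm m}
         (e-injective : Injective _≡_ _≡_ e) (firstReturn : IsFirstReturn σ e τ) where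

  firstReturn-reach : ∀ K → Acc _<_ K → ∀ {i j} → iter σ K (e i) ≡ e j → ∃[ L ] iter τ L i ≡ j
  firstReturn-reach zero    _        p = 0 , e-injective p
  firstReturn-reach (suc K) (acc rs) {i} p with excursion-skip σ e (firstReturn i) K p
  ... | K′ , K′≤K , q with firstReturn-reach K′ (rs (s≤s K′≤K)) q
  ... | L , r = suc L , trans (iter-sucʳ τ L i) r

  IsFullCycle-firstReturn : IsFullCycle σ → IsFullCycle τ
  IsFullCycle-firstReturn cycle i j with cycle (e i) (e j)
  ... | K , p = firstReturn-reach K (<-wellFounded K) p

X-fromℕ : ∀ m → X m (fromℕ m) ≡ zero
X-fromℕ m with m ≟ toℕ (fromℕ m)
... | yes _ = refl
... | no ne = ⊥-elim (ne (sym (toℕ-fromℕ m)))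

X-inject₁ : ∀ m (i : Fin m) → X m (inject₁ i) ≡ suc i
X-inject₁ m i with m ≟ toℕ (inject₁ i)
... | yes eq = ⊥-elim (<⇒≢ (toℕ<n i) (sym (trans eq (toℕ-inject₁ i))))
... | no ne  = cong suc (lower₁-inject₁′ i ne)

X⁻¹ : ∀ m → Fin (suc m) → Fin (suc m)
X⁻¹ m zero    = fromℕ m
X⁻¹ m (suc i) = inject₁ i

Xₚ : ∀ m → Perm (suc m)
Xₚ m = permutation (X m) (X⁻¹ m) X-X⁻¹ X⁻¹-X
  where
  X-X⁻¹ : ∀ y → X m (X⁻¹ m y) ≡ y
  X-X⁻¹ zero    = X-fromℕ m
  X-X⁻¹ (suc i) = X-inject₁ m i

  X⁻¹-X : ∀ x → X⁻¹ m (X m x) ≡ x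
  X⁻¹-X x with view x
  ... | ‵fromℕ     = cong (X⁻¹ m) (X-fromℕ m)
  ... | ‵inject₁ i = cong (X⁻¹ m) (X-inject₁ m i)

pinch-fromℕ-inject₁ : ∀ {n} (j : Fin (suc n)) → pinch (fromℕ n) (inject₁ j) ≡ j
pinch-fromℕ-inject₁         zero    = refl
pinch-fromℕ-inject₁ {suc n} (suc j) = cong suc (pinch-fromℕ-inject₁ j)

module Embedding (k : ℕ) where

  N : Fin (suc (suc (suc k)))
  N = fromℕ (suc (suc k))

  e : Fin (suc k) → Fin (suc (suc (suc k)))
  e j = suc (inject₁ j)

  e′ : Fin (suc k) → Fin (suc (suc (suc k)))
  e′ zero    = zero
  e′ (suc j) = e (suc j)

  -- A common retraction of e and e′; its value at N is irrelevant.
  pr : Fin (suc (suc (suc k))) → Fin (suc k)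
  pr zero    = zero
  pr (suc y) = pinch (fromℕ k) y

  data Position : Fin (suc (suc (suc k))) → Set where
    first : Position zero
    last  : Position N
    inner : ∀ j → Position (e j)

  position : ∀ y → Position y
  position zero = first
  position (suc y) with view y
  ... | ‵fromℕ     = last
  ... | ‵inject₁ j = inner j

  e-injective : Injective _≡_ _≡_ e
  e-injective = inject₁-injective ∘ suc-injective

  e≢zero : ∀ j → e j ≢ zero
  e≢zero j ()

  e≢N : ∀ j → e j ≢ N
  e≢N j = fromℕ≢inject₁ ∘ sym ∘ suc-injective

  e′≢N : ∀ j → e′ j ≢ N
  e′≢N zero    ()
  e′≢N (suc j) = e≢N (suc j)

  e′≢1 : ∀ j → e′ j ≢ suc zero
  e′≢1 zero    ()
  e′≢1 (suc j) ()

  ≡zero⇒∉e : ∀ {y} → y ≡ zero → ∀ j → y ≢ e j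
  ≡zero⇒∉e refl j = e≢zero j ∘ sym

  ≡N⇒∉e : ∀ {y} → y ≡ N → ∀ j → y ≢ e j
  ≡N⇒∉e refl j = e≢N j ∘ sym

  pr-e : ∀ j → pr (e j) ≡ j
  pr-e = pinch-fromℕ-inject₁

  pr-e′ : ∀ j → pr (e′ j) ≡ j
  pr-e′ zero    = refl
  pr-e′ (suc j) = pr-e (suc j)

  e-pr : ∀ y → y ≢ zero → y ≢ N → e (pr y) ≡ y
  e-pr y y≢0 y≢N with position y
  ... | first   = ⊥-elim (y≢0 refl)
  ... | last    = ⊥-elim (y≢N refl)
  ... | inner j = cong e (pr-e j)

  e′-pr : ∀ y → y ≢ N → y ≢ suc zero → e′ (pr y) ≡ y
  e′-pr y y≢N y≢1 with position y
  ... | first         = refl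
  ... | last          = ⊥-elim (y≢N refl)
  ... | inner zero    = ⊥-elim (y≢1 refl)
  ... | inner (suc j) = cong e′ (pr-e (suc j))

  X-e : ∀ i → X (suc (suc k)) (e i) ≡ suc (suc i)
  X-e i = X-inject₁ (suc (suc k)) (suc i)

module Contraction (k : ℕ) (γ₁ δ₁ : Perm (suc (suc (suc k))))
  (γ₁δ₁≡X : ∀ i → γ₁ ⟨$⟩ʳ (δ₁ ⟨$⟩ʳ i) ≡ X (suc (suc k)) i)
  (δ₁0≡N : δ₁ ⟨$⟩ʳ zero ≡ fromℕ (suc (suc k)))
  (δ₁N≡1 : δ₁ ⟨$⟩ʳ fromℕ (suc (suc k)) ≡ suc zero) where

  open Embedding k

  δ₁e≢N : ∀ j → δ₁ ⟨$⟩ʳ e j ≢ N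
  δ₁e≢N j p = e≢zero j (⟨$⟩ʳ-injective δ₁ (trans p (sym δ₁0≡N)))

  δ₁e≢1 : ∀ j → δ₁ ⟨$⟩ʳ e j ≢ suc zero
  δ₁e≢1 j p = e≢N j (⟨$⟩ʳ-injective δ₁ (trans p (sym δ₁N≡1)))

  δ₁⁻¹e′≢0 : ∀ j → δ₁ ⟨$⟩ˡ e′ j ≢ zero
  δ₁⁻¹e′≢0 j p = e′≢N j (trans (sym (inverseʳ δ₁)) (trans (cong (δ₁ ⟨$⟩ʳ_) p) δ₁0≡N))

  δ₁⁻¹e′≢N : ∀ j → δ₁ ⟨$⟩ˡ e′ j ≢ N
  δ₁⁻¹e′≢N j p = e′≢1 j (trans (sym (inverseʳ δ₁)) (trans (cong (δ₁ ⟨$⟩ʳ_) p) δ₁N≡1))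

  δ-to : Fin (suc k) → Fin (suc k)
  δ-to j = pr (δ₁ ⟨$⟩ʳ e j)

  δ-from : Fin (suc k) → Fin (suc k)
  δ-from j = pr (δ₁ ⟨$⟩ˡ e′ j)

  -- δ₁ maps the image of e onto that of e′, since it maps {0, N} onto {N, 1}.
  δ₁-e : ∀ j → δ₁ ⟨$⟩ʳ e j ≡ e′ (δ-to j)
  δ₁-e j = sym (e′-pr _ (δ₁e≢N j) (δ₁e≢1 j))

  δ₁⁻¹-e′ : ∀ j → δ₁ ⟨$⟩ˡ e′ j ≡ e (δ-from j)
  δ₁⁻¹-e′ j = sym (e-pr _ (δ₁⁻¹e′≢0 j) (δ₁⁻¹e′≢N j))

  δ : Perm (suc k)
  δ = permutation δ-to δ-from δ-to-from δ-from-to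
    where
    δ-to-from : ∀ j → δ-to (δ-from j) ≡ j
    δ-to-from j = begin
      pr (δ₁ ⟨$⟩ʳ e (δ-from j))        ≡⟨ cong (pr ∘ (δ₁ ⟨$⟩ʳ_)) (δ₁⁻¹-e′ j) ⟨
      pr (δ₁ ⟨$⟩ʳ (δ₁ ⟨$⟩ˡ e′ j))     ≡⟨ cong pr (inverseʳ δ₁) ⟩
      pr (e′ j)                        ≡⟨ pr-e′ j ⟩
      j                                ∎

    δ-from-to : ∀ j → δ-from (δ-to j) ≡ j
    δ-from-to j = begin
      pr (δ₁ ⟨$⟩ˡ e′ (δ-to j))         ≡⟨ cong (pr ∘ (δ₁ ⟨$⟩ˡ_)) (δ₁-e j) ⟨
      pr (δ₁ ⟨$⟩ˡ (δ₁ ⟨$⟩ʳ e j))      ≡⟨ cong pr (inverseˡ δ₁) ⟩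
      pr (e j)                         ≡⟨ pr-e j ⟩
      j                                ∎

  γ : Perm (suc k)
  γ = flip δ ∘ₚ Xₚ k

  γδ≡X : ∀ i → γ ⟨$⟩ʳ (δ ⟨$⟩ʳ i) ≡ X k i
  γδ≡X i = cong (X k) (inverseˡ δ)

  δ-firstReturn : IsFirstReturn δ₁ e δ
  δ-firstReturn j = excursion (δ-to j) (δ₁-e j)
    where
    excursion : ∀ {x} t → δ₁ ⟨$⟩ʳ x ≡ e′ t → Excursion δ₁ e x (e t)
    excursion (suc t) δ₁x≡et = arrive δ₁x≡et
    excursion zero    δ₁x≡0  =
      pass (≡zero⇒∉e δ₁x≡0) (pass (≡N⇒∉e δ₁²x≡N) (arrive (trans (cong (δ₁ ⟨$⟩ʳ_) δ₁²x≡N) δ₁N≡1)))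
      where
      δ₁²x≡N : δ₁ ⟨$⟩ʳ (δ₁ ⟨$⟩ʳ _) ≡ N
      δ₁²x≡N = trans (cong (δ₁ ⟨$⟩ʳ_) δ₁x≡0) δ₁0≡N

  γ₁N≡1 : γ₁ ⟨$⟩ʳ N ≡ suc zero
  γ₁N≡1 = trans (cong (γ₁ ⟨$⟩ʳ_) (sym δ₁0≡N)) (γ₁δ₁≡X zero)

  γ₁1≡0 : γ₁ ⟨$⟩ʳ suc zero ≡ zero
  γ₁1≡0 = trans (cong (γ₁ ⟨$⟩ʳ_) (sym δ₁N≡1)) (trans (γ₁δ₁≡X N) (X-fromℕ (suc (suc k))))

  -- X_n agrees with X_k under e except at e k ↦ N ↦ 1 = e (X_k k).
  γ₁-excursion-X : ∀ {x} i → γ₁ ⟨$⟩ʳ x ≡ X (suc (suc k)) (e i) → Excursion γ₁ e x (e (X k i))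
  γ₁-excursion-X i γ₁x≡Xei with view i
  ... | ‵fromℕ = pass (≡N⇒∉e γ₁x≡N) (arrive (begin
    γ₁ ⟨$⟩ʳ (γ₁ ⟨$⟩ʳ _) ≡⟨ cong (γ₁ ⟨$⟩ʳ_) γ₁x≡N ⟩
    γ₁ ⟨$⟩ʳ N           ≡⟨ γ₁N≡1 ⟩
    e zero              ≡⟨ cong e (X-fromℕ k) ⟨
    e (X k (fromℕ k))   ∎))
    where
    γ₁x≡N : γ₁ ⟨$⟩ʳ _ ≡ N
    γ₁x≡N = trans γ₁x≡Xei (X-e (fromℕ k))
  ... | ‵inject₁ i′ = arrive (trans γ₁x≡Xei (trans (X-e (inject₁ i′)) (cong e (sym (X-inject₁ k i′)))))

  γ₁-e′ : ∀ j → γ₁ ⟨$⟩ʳ e′ j ≡ X (suc (suc k)) (e (δ ⟨$⟩ˡ j))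
  γ₁-e′ j = begin
    γ₁ ⟨$⟩ʳ e′ j                           ≡⟨ cong ((γ₁ ⟨$⟩ʳ_) ∘ e′) (inverseʳ δ) ⟨
    γ₁ ⟨$⟩ʳ e′ (δ ⟨$⟩ʳ (δ ⟨$⟩ˡ j))          ≡⟨ cong (γ₁ ⟨$⟩ʳ_) (δ₁-e (δ ⟨$⟩ˡ j)) ⟨
    γ₁ ⟨$⟩ʳ (δ₁ ⟨$⟩ʳ e (δ ⟨$⟩ˡ j))          ≡⟨ γ₁δ₁≡X (e (δ ⟨$⟩ˡ j)) ⟩
    X (suc (suc k)) (e (δ ⟨$⟩ˡ j))          ∎

  γ-firstReturn : IsFirstReturn γ₁ e γ
  γ-firstReturn zero    = pass (≡zero⇒∉e γ₁1≡0)
    (γ₁-excursion-X (δ ⟨$⟩ˡ zero) (trans (cong (γ₁ ⟨$⟩ʳ_) γ₁1≡0) (γ₁-e′ zero)))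
  γ-firstReturn (suc j) = γ₁-excursion-X (δ ⟨$⟩ˡ suc j) (γ₁-e′ (suc j))

module _ (k : ℕ) where

  open Embedding k

  contract : SetB₁ k → SetA k
  contract (((γ₁ , δ₁) , γ₁-cycle , δ₁-cycle , γ₁δ₁≡X) , δ₁0≡N , δ₁N≡1) =
    (C.γ , C.δ) ,
    IsFullCycle-firstReturn e-injective C.γ-firstReturn γ₁-cycle ,
    IsFullCycle-firstReturn e-injective C.δ-firstReturn δ₁-cycle ,
    C.γδ≡X
    where module C = Contraction k γ₁ δ₁ γ₁δ₁≡X δ₁0≡N δ₁N≡1

  contract-cong : ∀ b b′ → proj₁ b ≈FP proj₁ b′ → contract b ≈FP contract b′
  contract-cong (((_ , δ₁) , _) , _) (((_ , δ₁′) , _) , _) (_ , δ₁≈δ₁′) =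
    (λ j → cong (X k ∘ pr) (⟨$⟩ˡ-cong δ₁ δ₁′ δ₁≈δ₁′ (e′ j))) ,
    (λ j → cong pr (δ₁≈δ₁′ (e j)))

  contract-injective : ∀ b b′ → contract b ≈FP contract b′ → proj₁ b ≈FP proj₁ b′
  contract-injective (((γ₁ , δ₁) , _ , _ , γ₁δ₁≡X) , δ₁0≡N , δ₁N≡1)
                     (((γ₁′ , δ₁′) , _ , _ , γ₁′δ₁′≡X) , δ₁′0≡N , δ₁′N≡1) (_ , δ≈δ′) =
    ≈ₚ-cancelʳ γ₁ γ₁′ δ₁ δ₁′ δ₁≈δ₁′ (λ i → trans (γ₁δ₁≡X i) (sym (γ₁′δ₁′≡X i))) , δ₁≈δ₁′
    where
    module C  = Contraction k γ₁ δ₁ γ₁δ₁≡X δ₁0≡N δ₁N≡1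
    module C′ = Contraction k γ₁′ δ₁′ γ₁′δ₁′≡X δ₁′0≡N δ₁′N≡1

    δ₁≈δ₁′ : δ₁ ≈ₚ δ₁′
    δ₁≈δ₁′ x with position x
    ... | first   = trans δ₁0≡N (sym δ₁′0≡N)
    ... | last    = trans δ₁N≡1 (sym δ₁′N≡1)
    ... | inner j = begin
      δ₁ ⟨$⟩ʳ e j         ≡⟨ C.δ₁-e j ⟩
      e′ (C.δ ⟨$⟩ʳ j)     ≡⟨ cong e′ (δ≈δ′ j) ⟩
      e′ (C′.δ ⟨$⟩ʳ j)    ≡⟨ C′.δ₁-e j ⟨
      δ₁′ ⟨$⟩ʳ e j        ∎

lemma3p8 : (k : ℕ) →
    Σ (SetB₁ k → SetA k) λ f →
      (∀ b b' → proj₁ b ≈FP proj₁ b' → f b ≈FP f b') ×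
      (∀ b b' → f b ≈FP f b' → proj₁ b ≈FP proj₁ b')
lemma3p8 k = contract k , contract-cong k , contract-injective k
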